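{- Let $\mathbb{F}_q$ be a finite field, let $n$ be a divisor of $q-1$, let $\gamma\in\mathbb{F}_q^*$ have order $n$, and let $G=\langle\gamma\rangle$. Let $U$ be any subset of $\{0,1,\ldots,n-1\}$, let $N$ be an integer, let $H\le n$ be a positive integer and let $V=\{N,N+1,\ldots,N+H-1\}$. Let $f:G\times G\to G$ be any mapping having $(\ell_1,\ell_2)$ as an index pair and satisfying $f(\gamma^x,\gamma^y)=\gamma^{xy}$ for all $(x,y)\in U\times V$. Then $$\max\{\ell_1,\ell_2\}\ge\min\{|U|,H\}.$$
   Context: For a positive divisor $\ell$ of $n$, let $C_{\ell,0}=\{\gamma^{j\ell}: j=0,1,\ldots,n/\ell-1\}$ and $C_{\ell,i}=\gamma^i C_{\ell,0}$ for $i=0,1,\ldots,\ell-1$. For positive divisors $\ell_1,\ell_2$ of $n$, a pair $(\ell_1,\ell_2)$ is called an index pair of a mapping $f:G\times G\to G$ if there exist positive integers $r_1,r_2$ and elements $a_{k_1,k_2}\in G$ ($0\le k_1\le \ell_1-1$, $0\le k_2\le \ell_2-1$) such that $f(x,y)=a_{k_1,k_2}x^{r_1}y^{r_2}$ whenever $(x,y)\in C_{\ell_1,k_1}\times C_{\ell_2,k_2}$. -}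

module Defs where

open import Level using (0ℓ)
open import Data.Nat as ℕ using (ℕ; zero; suc; _<_)
open import Data.Nat.Divisibility using (_∣_; quotient)
open import Data.Integer as ℤ using (ℤ; +_; -[1+_])
open import Data.Fin using (Fin)
open import Data.Product using (Σ; ∃; _×_; _,_)
open import Relation.Binary.PropositionalEquality using (_≡_; _≢_)
open import Relation.Nullary using (¬_)
open import Algebra.Structures using (IsCommutativeRing)
open import Function.Bundles using (_↔_)

-- A finite field with q elements (propositional equality, total inverse
-- function whose value at 0 is irrelevant).
record FiniteField : Set₁ where
  infixl 7 _*_
  infixl 6 _+_
  field
    Carrier : Set
    _+_ _*_ : Carrier → Carrier → Carrier
    -_ : Carrier → Carrier
    0# 1# : Carrier
    isCommutativeRing : IsCommutativeRing _≡_ _+_ _*_ -_ 0# 1#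
    0≢1 : 0# ≢ 1#
    _⁻¹ : Carrier → Carrier
    inverse : ∀ x → x ≢ 0# → x * (x ⁻¹) ≡ 1#
    q : ℕ
    enumeration : Fin q ↔ Carrier

  _^_ : Carrier → ℕ → Carrier
  x ^ zero  = 1#
  x ^ suc k = x * (x ^ k)

  _^ℤ_ : Carrier → ℤ → Carrier
  x ^ℤ (+ k)     = x ^ k
  x ^ℤ -[1+ k ]  = (x ⁻¹) ^ suc k

  HasOrder : Carrier → ℕ → Set
  HasOrder γ n = 0 < n × γ ^ n ≡ 1# × (∀ m → 0 < m → m < n → γ ^ m ≢ 1#)

  module _ (γ : Carrier) (n : ℕ) where

    InG : Carrier → Set
    InG x = ∃ λ i → x ≡ γ ^ i

    InC : (ℓ : ℕ) → ℓ ∣ n → ℕ → Carrier → Set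
    InC ℓ ℓ∣n k x = ∃ λ j → j < quotient ℓ∣n × x ≡ (γ ^ k) * (γ ^ (j ℕ.* ℓ))

    IsIndexPair : (f : Carrier → Carrier → Carrier) →
                  (ℓ₁ ℓ₂ : ℕ) → ℓ₁ ∣ n → ℓ₂ ∣ n → Set
    IsIndexPair f ℓ₁ ℓ₂ d₁ d₂ =
      Σ ℕ λ r₁ → Σ ℕ λ r₂ → Σ (Fin ℓ₁ → Fin ℓ₂ → Carrier) λ a →
        0 < r₁ × 0 < r₂ × (∀ k₁ k₂ → InG (a k₁ k₂)) ×
        (∀ (k₁ : Fin ℓ₁) (k₂ : Fin ℓ₂) x y →
           InC ℓ₁ d₁ (Data.Fin.toℕ k₁) x → InC ℓ₂ d₂ (Data.Fin.toℕ k₂) y →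
           f x y ≡ a k₁ k₂ * (x ^ r₁) * (y ^ r₂))

-- Two elements u < v of U with u ≡ v (mod ℓ₁) lie in the same coset C_{ℓ₁,k}, so
-- for every y the index-pair form gives f(γ^v, y) = f(γ^u, y) · γ^{(v-u) r₁}.
-- If H ≥ 2, comparing this with the interpolation property at y = γ^N and
-- y = γ^{N+1} forces γ^{v-u} = 1, contradicting the order of γ.  Hence u ↦ u mod ℓ₁
-- is injective on U and |U| ≤ ℓ₁; if H = 1 the bound is min(|U|, H) ≤ 1 ≤ ℓ₂.
module Submission where

open import Defs
open import Level using (0ℓ)
open import Function using (_∘_)
open import Data.Nat as ℕ using (ℕ; _<_; _≤_; _∸_; _⊔_; _⊓_; zero; suc; z≤n; s≤s; NonZero; pred; _%_; _/_)
import Data.Nat.Properties as ℕP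
open import Data.Nat.Divisibility using (_∣_)
open import Data.Nat.DivMod using (_mod_; _divMod_; module DivMod; m≡m%n+[m/n]*n; m%n<n; m<n*o⇒m/o<n)
open import Data.Integer as ℤ using (ℤ; +_; -[1+_]; _⊖_)
import Data.Integer.Properties as ℤP
open import Data.Integer.Tactic.RingSolver using (solve-∀)
open import Data.Fin using (Fin; toℕ)
open import Data.Fin.Properties using (suc-injective; toℕ-injective; toℕ<n; 0≢1+n)
open import Data.Fin.Subset using (Subset; _∈_; ∣_∣; inside; outside; ⊤; _-_)
open import Data.Fin.Subset.Properties using (x∈p∧x≢y⇒x∈p-y; x∈p⇒∣p-x∣<∣p∣; ∣⊤∣≡n; ∈⊤)
open import Data.Vec using (_∷_; []; here; there)
open import Data.Product using (∃; ∃₂; _,_)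
open import Relation.Binary.PropositionalEquality
  using (_≡_; _≢_; refl; sym; trans; cong; cong₂; subst; module ≡-Reasoning)
open import Relation.Binary.Definitions using (tri<; tri≈; tri>)
open import Relation.Nullary using (yes; no; contradiction)
open import Algebra.Bundles using (CommutativeSemigroup)
open import Algebra.Structures using (IsCommutativeRing; IsCommutativeMonoid)
import Algebra.Properties.CommutativeSemigroup as CommutativeSemigroupProperties

injectiveOn⇒∣p∣≤∣q∣ : ∀ {m n} (p : Subset m) (q : Subset n) (g : Fin m → Fin n) →
  (∀ {x} → x ∈ p → g x ∈ q) →
  (∀ {x y} → x ∈ p → y ∈ p → g x ≡ g y → x ≡ y) →
  ∣ p ∣ ≤ ∣ q ∣
injectiveOn⇒∣p∣≤∣q∣ [] q g into inj = z≤n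
injectiveOn⇒∣p∣≤∣q∣ (outside ∷ p) q g into inj =
  injectiveOn⇒∣p∣≤∣q∣ p q (g ∘ Fin.suc) (into ∘ there)
    (λ x∈p y∈p → suc-injective ∘ inj (there x∈p) (there y∈p))
injectiveOn⇒∣p∣≤∣q∣ (inside ∷ p) q g into inj =
  ℕP.≤-trans (s≤s (injectiveOn⇒∣p∣≤∣q∣ p (q - g Fin.zero) (g ∘ Fin.suc) into-rest inj-rest))
             (x∈p⇒∣p-x∣<∣p∣ (into here))
  where
  into-rest : ∀ {x} → x ∈ p → g (Fin.suc x) ∈ q - g Fin.zero
  into-rest x∈p = x∈p∧x≢y⇒x∈p-y (into (there x∈p)) (0≢1+n ∘ inj here (there x∈p) ∘ sym)

  inj-rest : ∀ {x y} → x ∈ p → y ∈ p → g (Fin.suc x) ≡ g (Fin.suc y) → x ≡ y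
  inj-rest x∈p y∈p = suc-injective ∘ inj (there x∈p) (there y∈p)

⊖-surjective : ∀ z → ∃₂ λ a b → z ≡ a ⊖ b
⊖-surjective (+ a)    = a , 0 , refl
⊖-surjective -[1+ b ] = 0 , suc b , refl

⊖-+-⊖ : ∀ a b c d → (a ⊖ b) ℤ.+ (c ⊖ d) ≡ (a ℕ.+ c) ⊖ (b ℕ.+ d)
⊖-+-⊖ a b c d = begin
  (a ⊖ b) ℤ.+ (c ⊖ d)                ≡⟨ cong₂ ℤ._+_ (ℤP.[+m]-[+n]≡m⊖n a b) (ℤP.[+m]-[+n]≡m⊖n c d) ⟨
  (+ a ℤ.- + b) ℤ.+ (+ c ℤ.- + d)    ≡⟨ regroup (+ a) (+ b) (+ c) (+ d) ⟩
  (+ a ℤ.+ + c) ℤ.- (+ b ℤ.+ + d)    ≡⟨ cong₂ ℤ._-_ (ℤP.pos-+ a c) (ℤP.pos-+ b d) ⟨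
  + (a ℕ.+ c) ℤ.- + (b ℕ.+ d)        ≡⟨ ℤP.[+m]-[+n]≡m⊖n (a ℕ.+ c) (b ℕ.+ d) ⟩
  (a ℕ.+ c) ⊖ (b ℕ.+ d)              ∎
  where
  open ≡-Reasoning
  regroup : ∀ A B C D → (A ℤ.- B) ℤ.+ (C ℤ.- D) ≡ (A ℤ.+ C) ℤ.- (B ℤ.+ D)
  regroup = solve-∀

module FieldPowers (𝔽 : FiniteField) where
  open FiniteField 𝔽
  open IsCommutativeRing isCommutativeRing
    using (*-assoc; *-comm; *-identityˡ; *-identityʳ; zeroˡ; *-isCommutativeMonoid)
  open ≡-Reasoning

  *-commutativeSemigroup : CommutativeSemigroup 0ℓ 0ℓ
  *-commutativeSemigroup = record
    { isCommutativeSemigroup = IsCommutativeMonoid.isCommutativeSemigroup *-isCommutativeMonoid }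

  open CommutativeSemigroupProperties *-commutativeSemigroup using (interchange; xy∙z≈xz∙y)

  ^-distribˡ-+-* : ∀ x m n → x ^ (m ℕ.+ n) ≡ x ^ m * x ^ n
  ^-distribˡ-+-* x zero    n = sym (*-identityˡ (x ^ n))
  ^-distribˡ-+-* x (suc m) n = trans (cong (x *_) (^-distribˡ-+-* x m n)) (sym (*-assoc x _ _))

  ^-*-assoc : ∀ x m n → (x ^ m) ^ n ≡ x ^ (n ℕ.* m)
  ^-*-assoc x m zero    = refl
  ^-*-assoc x m (suc n) =
    trans (cong (x ^ m *_) (^-*-assoc x m n)) (sym (^-distribˡ-+-* x m (n ℕ.* m)))

  ^-zeroˡ : ∀ n → 1# ^ n ≡ 1#
  ^-zeroˡ zero    = refl
  ^-zeroˡ (suc n) = trans (*-identityˡ (1# ^ n)) (^-zeroˡ n)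

  ^-distribʳ-* : ∀ x y n → (x * y) ^ n ≡ x ^ n * y ^ n
  ^-distribʳ-* x y zero    = sym (*-identityˡ 1#)
  ^-distribʳ-* x y (suc n) =
    trans (cong (x * y *_) (^-distribʳ-* x y n)) (interchange x y (x ^ n) (y ^ n))

  *-cancelˡ-invertible : ∀ {w z a b} → w * z ≡ 1# → z * a ≡ z * b → a ≡ b
  *-cancelˡ-invertible {w} {z} {a} {b} wz≡1 za≡zb = begin
    a            ≡⟨ *-identityˡ a ⟨
    1# * a       ≡⟨ cong (_* a) wz≡1 ⟨
    w * z * a    ≡⟨ *-assoc w z a ⟩
    w * (z * a)  ≡⟨ cong (w *_) za≡zb ⟩
    w * (z * b)  ≡⟨ *-assoc w z b ⟨
    w * z * b    ≡⟨ cong (_* b) wz≡1 ⟩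
    1# * b       ≡⟨ *-identityˡ b ⟩
    b            ∎

  module IntegerPowers (x : Carrier) (x≢0 : x ≢ 0#) where

    ^ℤ-⊖ : ∀ a b → x ^ℤ (a ⊖ b) ≡ x ^ a * (x ⁻¹) ^ b
    ^ℤ-⊖ a       zero    = sym (*-identityʳ (x ^ a))
    ^ℤ-⊖ zero    (suc b) = sym (*-identityˡ ((x ⁻¹) ^ suc b))
    ^ℤ-⊖ (suc a) (suc b) = begin
      x ^ℤ (suc a ⊖ suc b)                   ≡⟨ cong (x ^ℤ_) (ℤP.[1+m]⊖[1+n]≡m⊖n a b) ⟩
      x ^ℤ (a ⊖ b)                           ≡⟨ ^ℤ-⊖ a b ⟩
      x ^ a * (x ⁻¹) ^ b                     ≡⟨ *-identityˡ _ ⟨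
      1# * (x ^ a * (x ⁻¹) ^ b)              ≡⟨ cong (_* (x ^ a * (x ⁻¹) ^ b)) (inverse x x≢0) ⟨
      x * x ⁻¹ * (x ^ a * (x ⁻¹) ^ b)        ≡⟨ interchange x (x ⁻¹) (x ^ a) ((x ⁻¹) ^ b) ⟩
      x * x ^ a * (x ⁻¹ * (x ⁻¹) ^ b)        ∎

    ^ℤ-homo-+ : ∀ z w → x ^ℤ (z ℤ.+ w) ≡ x ^ℤ z * x ^ℤ w
    ^ℤ-homo-+ z w with ⊖-surjective z | ⊖-surjective w
    ... | a , b , refl | c , d , refl = begin
      x ^ℤ ((a ⊖ b) ℤ.+ (c ⊖ d))                       ≡⟨ cong (x ^ℤ_) (⊖-+-⊖ a b c d) ⟩
      x ^ℤ ((a ℕ.+ c) ⊖ (b ℕ.+ d))                     ≡⟨ ^ℤ-⊖ (a ℕ.+ c) (b ℕ.+ d) ⟩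
      x ^ (a ℕ.+ c) * (x ⁻¹) ^ (b ℕ.+ d)               ≡⟨ cong₂ _*_ (^-distribˡ-+-* x a c)
                                                                    (^-distribˡ-+-* (x ⁻¹) b d) ⟩
      x ^ a * x ^ c * ((x ⁻¹) ^ b * (x ⁻¹) ^ d)        ≡⟨ interchange _ _ _ _ ⟩
      x ^ a * (x ⁻¹) ^ b * (x ^ c * (x ⁻¹) ^ d)        ≡⟨ cong₂ _*_ (^ℤ-⊖ a b) (^ℤ-⊖ c d) ⟨
      x ^ℤ (a ⊖ b) * x ^ℤ (c ⊖ d)                      ∎

    ^ℤ-cancelˡ : ∀ z {a b} → x ^ℤ z * a ≡ x ^ℤ z * b → a ≡ b
    ^ℤ-cancelˡ z = *-cancelˡ-invertible
      (trans (sym (^ℤ-homo-+ (ℤ.- z) z)) (cong (x ^ℤ_) (ℤP.+-inverseˡ z)))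

    ^ℤ-+-*-ratio : ∀ u δ W {c} → x ^ℤ (+ (u ℕ.+ δ) ℤ.* W) ≡ x ^ℤ (+ u ℤ.* W) * c →
                   x ^ℤ (+ δ ℤ.* W) ≡ c
    ^ℤ-+-*-ratio u δ W {c} e = ^ℤ-cancelˡ (+ u ℤ.* W) (begin
      x ^ℤ (+ u ℤ.* W) * x ^ℤ (+ δ ℤ.* W)    ≡⟨ ^ℤ-homo-+ (+ u ℤ.* W) (+ δ ℤ.* W) ⟨
      x ^ℤ (+ u ℤ.* W ℤ.+ + δ ℤ.* W)         ≡⟨ cong (x ^ℤ_) distrib ⟨
      x ^ℤ (+ (u ℕ.+ δ) ℤ.* W)               ≡⟨ e ⟩
      x ^ℤ (+ u ℤ.* W) * c                   ∎)
      where
      distrib : + (u ℕ.+ δ) ℤ.* W ≡ + u ℤ.* W ℤ.+ + δ ℤ.* W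
      distrib = trans (cong (ℤ._* W) (ℤP.pos-+ u δ)) (ℤP.*-distribʳ-+ W (+ u) (+ δ))

    ^ℤ-*-suc-invariant⇒^≡1 : ∀ δ Z → x ^ℤ (+ δ ℤ.* Z) ≡ x ^ℤ (+ δ ℤ.* (Z ℤ.+ + 1)) → x ^ δ ≡ 1#
    ^ℤ-*-suc-invariant⇒^≡1 δ Z e = sym (^ℤ-cancelˡ (+ δ ℤ.* Z) (begin
      x ^ℤ (+ δ ℤ.* Z) * 1#              ≡⟨ *-identityʳ _ ⟩
      x ^ℤ (+ δ ℤ.* Z)                   ≡⟨ e ⟩
      x ^ℤ (+ δ ℤ.* (Z ℤ.+ + 1))         ≡⟨ cong (x ^ℤ_) distrib ⟩
      x ^ℤ (+ δ ℤ.* Z ℤ.+ + δ)           ≡⟨ ^ℤ-homo-+ (+ δ ℤ.* Z) (+ δ) ⟩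
      x ^ℤ (+ δ ℤ.* Z) * x ^ δ           ∎))
      where
      distrib : + δ ℤ.* (Z ℤ.+ + 1) ≡ + δ ℤ.* Z ℤ.+ + δ
      distrib = trans (ℤP.*-distribˡ-+ (+ δ) Z (+ 1)) (cong (ℤ._+_ (+ δ ℤ.* Z)) (ℤP.*-identityʳ (+ δ)))

  module Cyclic (γ : Carrier) (n : ℕ) .{{_ : NonZero n}} (γ^n≡1 : γ ^ n ≡ 1#) where

    γ*γ^pred-n≡1 : γ * γ ^ pred n ≡ 1#
    γ*γ^pred-n≡1 = trans (cong (γ ^_) (ℕP.suc-pred n)) γ^n≡1

    γ≢0 : γ ≢ 0#
    γ≢0 γ≡0 = 0≢1 (begin
      0#                 ≡⟨ zeroˡ (γ ^ pred n) ⟨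
      0# * γ ^ pred n    ≡⟨ cong (_* γ ^ pred n) γ≡0 ⟨
      γ * γ ^ pred n     ≡⟨ γ*γ^pred-n≡1 ⟩
      1#                 ∎)

    open IntegerPowers γ γ≢0 public

    γ⁻¹≡γ^pred-n : γ ⁻¹ ≡ γ ^ pred n
    γ⁻¹≡γ^pred-n = *-cancelˡ-invertible
      (trans (*-comm (γ ⁻¹) γ) (inverse γ γ≢0))
      (trans (inverse γ γ≢0) (sym γ*γ^pred-n≡1))

    ^-mod : ∀ m → γ ^ m ≡ γ ^ (m % n)
    ^-mod m = begin
      γ ^ m                              ≡⟨ cong (γ ^_) (m≡m%n+[m/n]*n m n) ⟩
      γ ^ (m % n ℕ.+ m / n ℕ.* n)        ≡⟨ ^-distribˡ-+-* γ (m % n) (m / n ℕ.* n) ⟩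
      γ ^ (m % n) * γ ^ (m / n ℕ.* n)    ≡⟨ cong (γ ^ (m % n) *_) (^-*-assoc γ n (m / n)) ⟨
      γ ^ (m % n) * (γ ^ n) ^ (m / n)    ≡⟨ cong (λ y → γ ^ (m % n) * y ^ (m / n)) γ^n≡1 ⟩
      γ ^ (m % n) * 1# ^ (m / n)         ≡⟨ cong (γ ^ (m % n) *_) (^-zeroˡ (m / n)) ⟩
      γ ^ (m % n) * 1#                   ≡⟨ *-identityʳ _ ⟩
      γ ^ (m % n)                        ∎

    ^ℤ∈G : ∀ z → InG γ n (γ ^ℤ z)
    ^ℤ∈G (+ k)    = k , refl
    ^ℤ∈G -[1+ k ] = suc k ℕ.* pred n ,
      trans (cong (_^ suc k) γ⁻¹≡γ^pred-n) (^-*-assoc γ (pred n) (suc k))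

    ^∈C : ∀ {ℓ} .{{_ : NonZero ℓ}} (ℓ∣n : ℓ ∣ n) {u} → u < n →
          InC γ n ℓ ℓ∣n (toℕ (u mod ℓ)) (γ ^ u)
    ^∈C {ℓ} ℓ∣n {u} u<n =
      u / ℓ ,
      m<n*o⇒m/o<n (subst (u <_) (_∣_.equality ℓ∣n) u<n) ,
      trans (cong (γ ^_) (DivMod.property (u divMod ℓ))) (^-distribˡ-+-* γ (toℕ (u mod ℓ)) (u / ℓ ℕ.* ℓ))

    ∈G⇒∈C : ∀ {ℓ} .{{_ : NonZero ℓ}} (ℓ∣n : ℓ ∣ n) {y} → InG γ n y →
            ∃ λ (k : Fin ℓ) → InC γ n ℓ ℓ∣n (toℕ k) y
    ∈G⇒∈C {ℓ} ℓ∣n (i , y≡γ^i) =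
      (i % n) mod ℓ ,
      subst (InC γ n ℓ ℓ∣n (toℕ ((i % n) mod ℓ))) (sym (trans y≡γ^i (^-mod i))) (^∈C ℓ∣n (m%n<n i n))

    module IndexPair
      (f : Carrier → Carrier → Carrier)
      {ℓ₁ ℓ₂ : ℕ} .{{_ : NonZero ℓ₁}} .{{_ : NonZero ℓ₂}} (d₁ : ℓ₁ ∣ n) (d₂ : ℓ₂ ∣ n)
      (r₁ r₂ : ℕ) (a : Fin ℓ₁ → Fin ℓ₂ → Carrier)
      (f-on-cosets : ∀ k₁ k₂ x y → InC γ n ℓ₁ d₁ (toℕ k₁) x → InC γ n ℓ₂ d₂ (toℕ k₂) y →
                     f x y ≡ a k₁ k₂ * (x ^ r₁) * (y ^ r₂))
      where

      same-coset-shift : ∀ {u δ} → u ℕ.+ δ < n → u mod ℓ₁ ≡ (u ℕ.+ δ) mod ℓ₁ → ∀ z →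
        f (γ ^ (u ℕ.+ δ)) (γ ^ℤ z) ≡ f (γ ^ u) (γ ^ℤ z) * (γ ^ δ) ^ r₁
      same-coset-shift {u} {δ} u+δ<n same z with ∈G⇒∈C d₂ (^ℤ∈G z)
      ... | k₂ , y∈C = begin
        f (γ ^ (u ℕ.+ δ)) y                      ≡⟨ f-on-cosets k₁ k₂ _ _ u+δ∈C y∈C ⟩
        b * (γ ^ (u ℕ.+ δ)) ^ r₁ * y ^ r₂        ≡⟨ cong (λ w → b * w ^ r₁ * y ^ r₂)
                                                        (^-distribˡ-+-* γ u δ) ⟩
        b * (γ ^ u * γ ^ δ) ^ r₁ * y ^ r₂        ≡⟨ cong (λ w → b * w * y ^ r₂)
                                                        (^-distribʳ-* (γ ^ u) (γ ^ δ) r₁) ⟩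
        b * ((γ ^ u) ^ r₁ * P) * y ^ r₂          ≡⟨ cong (_* y ^ r₂) (*-assoc b _ P) ⟨
        b * (γ ^ u) ^ r₁ * P * y ^ r₂            ≡⟨ xy∙z≈xz∙y (b * (γ ^ u) ^ r₁) P (y ^ r₂) ⟩
        b * (γ ^ u) ^ r₁ * y ^ r₂ * P            ≡⟨ cong (_* P) (f-on-cosets k₁ k₂ _ _ u∈C y∈C) ⟨
        f (γ ^ u) y * P                          ∎
        where
        k₁ = u mod ℓ₁
        b = a k₁ k₂
        y = γ ^ℤ z
        P = (γ ^ δ) ^ r₁
        u∈C : InC γ n ℓ₁ d₁ (toℕ k₁) (γ ^ u)
        u∈C = ^∈C d₁ (ℕP.≤-<-trans (ℕP.m≤m+n u δ) u+δ<n)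
        u+δ∈C : InC γ n ℓ₁ d₁ (toℕ k₁) (γ ^ (u ℕ.+ δ))
        u+δ∈C = subst (λ k → InC γ n ℓ₁ d₁ (toℕ k) _) (sym same) (^∈C d₁ u+δ<n)

      module Interpolation
        (U : Subset n) (N : ℤ)
        (interpolates : ∀ (x : Fin n) t → x ∈ U → t < 2 →
                        f (γ ^ toℕ x) (γ ^ℤ (N ℤ.+ + t)) ≡ γ ^ℤ (+ toℕ x ℤ.* (N ℤ.+ + t)))
        where

        same-coset-gap-ratio : ∀ {x y} → x ∈ U → y ∈ U → ∀ {δ} → toℕ x ℕ.+ δ ≡ toℕ y →
          toℕ x mod ℓ₁ ≡ toℕ y mod ℓ₁ → ∀ t → t < 2 →
          γ ^ℤ (+ δ ℤ.* (N ℤ.+ + t)) ≡ (γ ^ δ) ^ r₁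
        same-coset-gap-ratio {x} {y} x∈U y∈U {δ} x+δ≡y same t t<2 =
          ^ℤ-+-*-ratio (toℕ x) δ Z (begin
            γ ^ℤ (+ (toℕ x ℕ.+ δ) ℤ.* Z)              ≡⟨ cong (λ v → γ ^ℤ (+ v ℤ.* Z)) x+δ≡y ⟩
            γ ^ℤ (+ toℕ y ℤ.* Z)                      ≡⟨ interpolates y t y∈U t<2 ⟨
            f (γ ^ toℕ y) (γ ^ℤ Z)                    ≡⟨ cong (λ v → f (γ ^ v) (γ ^ℤ Z)) x+δ≡y ⟨
            f (γ ^ (toℕ x ℕ.+ δ)) (γ ^ℤ Z)            ≡⟨ same-coset-shift x+δ<n same′ Z ⟩
            f (γ ^ toℕ x) (γ ^ℤ Z) * (γ ^ δ) ^ r₁     ≡⟨ cong (_* (γ ^ δ) ^ r₁) (interpolates x t x∈U t<2) ⟩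
            γ ^ℤ (+ toℕ x ℤ.* Z) * (γ ^ δ) ^ r₁       ∎)
          where
          Z = N ℤ.+ + t
          x+δ<n : toℕ x ℕ.+ δ < n
          x+δ<n = subst (_< n) (sym x+δ≡y) (toℕ<n y)
          same′ : toℕ x mod ℓ₁ ≡ (toℕ x ℕ.+ δ) mod ℓ₁
          same′ = trans same (cong (_mod ℓ₁) (sym x+δ≡y))

        same-coset-gap≡1 : ∀ {x y} → x ∈ U → y ∈ U → ∀ {δ} → toℕ x ℕ.+ δ ≡ toℕ y →
          toℕ x mod ℓ₁ ≡ toℕ y mod ℓ₁ → γ ^ δ ≡ 1#
        same-coset-gap≡1 x∈U y∈U {δ} x+δ≡y same =
          ^ℤ-*-suc-invariant⇒^≡1 δ (N ℤ.+ + 0) (begin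
            γ ^ℤ (+ δ ℤ.* (N ℤ.+ + 0))             ≡⟨ ratio 0 (s≤s z≤n) ⟩
            (γ ^ δ) ^ r₁                            ≡⟨ ratio 1 (s≤s (s≤s z≤n)) ⟨
            γ ^ℤ (+ δ ℤ.* (N ℤ.+ + 1))             ≡⟨ cong (λ Z → γ ^ℤ (+ δ ℤ.* Z))
                                                           (ℤP.+-assoc N (+ 0) (+ 1)) ⟨
            γ ^ℤ (+ δ ℤ.* (N ℤ.+ + 0 ℤ.+ + 1))     ∎)
          where
          ratio = same-coset-gap-ratio x∈U y∈U x+δ≡y same

        module _ (minimal : ∀ m → 0 < m → m < n → γ ^ m ≢ 1#) where

          <⇒different-cosets : ∀ {x y} → x ∈ U → y ∈ U → toℕ x < toℕ y →
                               toℕ x mod ℓ₁ ≢ toℕ y mod ℓ₁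
          <⇒different-cosets {x} {y} x∈U y∈U x<y same =
            minimal (toℕ y ∸ toℕ x) (ℕP.m<n⇒0<n∸m x<y)
              (ℕP.≤-<-trans (ℕP.m∸n≤m (toℕ y) (toℕ x)) (toℕ<n y))
              (same-coset-gap≡1 x∈U y∈U (ℕP.m+[n∸m]≡n (ℕP.<⇒≤ x<y)) same)

          mod-injectiveOn : ∀ {x y} → x ∈ U → y ∈ U → toℕ x mod ℓ₁ ≡ toℕ y mod ℓ₁ → x ≡ y
          mod-injectiveOn {x} {y} x∈U y∈U same with ℕP.<-cmp (toℕ x) (toℕ y)
          ... | tri< x<y _ _ = contradiction same (<⇒different-cosets x∈U y∈U x<y)
          ... | tri≈ _ x≡y _ = toℕ-injective x≡y
          ... | tri> _ _ y<x = contradiction (sym same) (<⇒different-cosets y∈U x∈U y<x)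

theorem6 : (𝔽 : FiniteField) → let open FiniteField 𝔽 in
    (n : ℕ) → n ∣ (q ∸ 1) →
    (γ : Carrier) → HasOrder γ n →
    (U : Subset n) → (N : ℤ) → (H : ℕ) → 0 < H → H ≤ n →
    (f : Carrier → Carrier → Carrier) →
    (∀ x y → InG γ n x → InG γ n y → InG γ n (f x y)) →
    (ℓ₁ ℓ₂ : ℕ) → 0 < ℓ₁ → 0 < ℓ₂ → (d₁ : ℓ₁ ∣ n) → (d₂ : ℓ₂ ∣ n) →
    IsIndexPair γ n f ℓ₁ ℓ₂ d₁ d₂ →
    (∀ (x : Fin n) (t : ℕ) → x ∈ U → t < H →
       f (γ ^ toℕ x) (γ ^ℤ (N ℤ.+ + t))
         ≡ γ ^ℤ ((+ toℕ x) ℤ.* (N ℤ.+ + t))) →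
    (∣ U ∣ ⊓ H) ≤ (ℓ₁ ⊔ ℓ₂)
theorem6 𝔽 n _ γ (0<n , γ^n≡1 , minimal) U N H _ _ f _ ℓ₁ ℓ₂ 0<ℓ₁ 0<ℓ₂ d₁ d₂
         (r₁ , r₂ , a , _ , _ , _ , f-on-cosets) interpolates with 2 ℕ.≤? H
... | no  H≱2 = ℕP.≤-trans (ℕP.m⊓n≤n ∣ U ∣ H)
                  (ℕP.≤-trans (ℕ.s≤s⁻¹ (ℕP.≰⇒> H≱2)) (ℕP.≤-trans 0<ℓ₂ (ℕP.m≤n⊔m ℓ₁ ℓ₂)))
... | yes 2≤H = ℕP.≤-trans (ℕP.m⊓n≤m ∣ U ∣ H) (ℕP.≤-trans ∣U∣≤ℓ₁ (ℕP.m≤m⊔n ℓ₁ ℓ₂))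
  where
  instance
    n≢0 = ℕ.>-nonZero 0<n
    ℓ₁≢0 = ℕ.>-nonZero 0<ℓ₁
    ℓ₂≢0 = ℕ.>-nonZero 0<ℓ₂
  open FieldPowers.Cyclic.IndexPair.Interpolation 𝔽 γ n γ^n≡1 f d₁ d₂ r₁ r₂ a f-on-cosets U N
    (λ x t x∈U t<2 → interpolates x t x∈U (ℕP.≤-trans t<2 2≤H))
    using (mod-injectiveOn)

  ∣U∣≤ℓ₁ : ∣ U ∣ ≤ ℓ₁
  ∣U∣≤ℓ₁ = subst (∣ U ∣ ≤_) (∣⊤∣≡n ℓ₁)
    (injectiveOn⇒∣p∣≤∣q∣ U ⊤ (λ x → toℕ x mod ℓ₁) (λ _ → ∈⊤) (mod-injectiveOn minimal))
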